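{- Let $n$, $t$, $s$ be positive integers with $n\geq t+s+2$, and let $\mathcal{F}\subseteq\binom{[n]}{t+1}$ be an $s$-almost $t$-intersecting family which is not $t$-intersecting and which has maximum size among all such families. Let $A,B\in\mathcal{F}$ with $A\setminus B=\{1,2\}$ and $B\setminus A=\{3,4\}$. Then: (i) $\mathcal{F}\setminus\mathcal{E}\subseteq \left(\mathcal{D}_{\mathcal{F}}(A;t)\cup \mathcal{D}_{\mathcal{F}}(B;t)\right)\setminus\{A,B\}$; (ii) $5+|\mathcal{D}|\leq |\mathcal{F}\cap\mathcal{E}|\leq 6$.
   Context: $\mathcal{F}$ is $s$-almost $t$-intersecting if $\left|\{F'\in\mathcal{F}: |F'\cap F|<t\}\right|\leq s$ for every $F\in\mathcal{F}$; $t$-intersecting if any two members share at least $t$ elements. For a family $\mathcal{G}$ and $H\subseteq[n]$, $\mathcal{D}_{\mathcal{G}}(H;t)=\{G\in\mathcal{G}: |G\cap H|<t\}$. Here $|A|=|B|=t+1$, $|A\cap B|=t-1$. For $i\in[4]$ and $x\in[n]\setminus\{i\}$ put $X_{i,x}=(A\cap B)\cup\{i,x\}$ if $x\notin A\cap B$, and $X_{i,x}=(A\cup B)\setminus\{i,x\}$ if $x\in A\cap B$. Set $\mathcal{D}=\mathcal{D}_{\mathcal{F}}(A;t)\cap\mathcal{D}_{\mathcal{F}}(B;t)$ and $\mathcal{E}=\{X_{i,x}:\{i,x\}\in\binom{[4]}{2}\}$ (a family of $6$ sets containing $A=X_{1,2}$ and $B=X_{3,4}$). -}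

module Defs where

open import Data.Nat using (ℕ; suc; _+_; _≤_; _<_; _<?_)
open import Data.Nat.Properties using (≤-trans; ≤-refl; +-mono-≤)
open import Data.Bool.Properties using () renaming (_≟_ to _≟B_)
open import Data.Fin using (Fin; zero; suc; inject≤)
open import Data.Fin.Subset using (Subset; _∩_; _∪_; ∁; ⁅_⁆; ∣_∣) renaming (_∈_ to _∈ₛ_; _∉_ to _∉ₛ_)
open import Data.Fin.Subset.Properties using () renaming (_∈?_ to _∈ₛ?_)
open import Data.Vec.Properties using (≡-dec)
open import Data.List using (List; []; _∷_; filter; length)
open import Data.List.Relation.Unary.Unique.Propositional using (Unique)
open import Data.Product using (_×_)
open import Data.Sum using (_⊎_)
open import Relation.Binary.PropositionalEquality using (_≡_)
open import Relation.Binary.Definitions using (DecidableEquality)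
open import Relation.Nullary using (¬_; yes; no)
open import Function.Bundles using (_⇔_)

_≟ₛ_ : ∀ {n} → DecidableEquality (Subset n)
_≟ₛ_ = ≡-dec _≟B_

-- A family of subsets of [n] is a duplicate-free list; membership / its decision.
module _ {n : ℕ} where
  open import Data.List.Membership.DecPropositional (_≟ₛ_ {n}) public
    using (_∈_; _∉_; _∈?_)

Family : ℕ → Set
Family n = List (Subset n)

D : ∀ {n} → Family n → Subset n → ℕ → Family n
D 𝓖 H t = filter (λ G → ∣ G ∩ H ∣ <? t) 𝓖

Uniform : ∀ {n} → ℕ → Family n → Set
Uniform k 𝓕 = ∀ F → F ∈ 𝓕 → ∣ F ∣ ≡ k

TIntersecting : ∀ {n} → ℕ → Family n → Set
TIntersecting t 𝓕 = ∀ F F′ → F ∈ 𝓕 → F′ ∈ 𝓕 → t ≤ ∣ F ∩ F′ ∣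

AlmostIntersecting : ∀ {n} → ℕ → ℕ → Family n → Set
AlmostIntersecting s t 𝓕 = ∀ F → F ∈ 𝓕 → length (D 𝓕 F t) ≤ s

Admissible : ∀ {n} → ℕ → ℕ → Family n → Set
Admissible t s 𝓕 = Unique 𝓕 × Uniform (suc t) 𝓕 × AlmostIntersecting s t 𝓕 × ¬ TIntersecting t 𝓕

MaxAdmissible : ∀ {n} → ℕ → ℕ → Family n → Set
MaxAdmissible {n} t s 𝓕 =
  Admissible t s 𝓕 × (∀ (𝓖 : Family n) → Admissible t s 𝓖 → length 𝓖 ≤ length 𝓕)

four≤ : ∀ {n t s} → 1 ≤ t → 1 ≤ s → t + s + 2 ≤ n → 4 ≤ n
four≤ ht hs hn = ≤-trans (+-mono-≤ (+-mono-≤ ht hs) ≤-refl) hn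

-- The elements 1,2,3,4 of [n] are represented by Fin 4 (0 ↦ 1, …, 3 ↦ 4) injected into Fin n.
el : ∀ {n} → 4 ≤ n → Fin 4 → Fin n
el h i = inject≤ i h

X : ∀ {n} → Subset n → Subset n → Fin n → Fin n → Subset n
X A B i x with x ∈ₛ? (A ∩ B)
... | no  _ = (A ∩ B) ∪ (⁅ i ⁆ ∪ ⁅ x ⁆)
... | yes _ = (A ∪ B) ∩ ∁ (⁅ i ⁆ ∪ ⁅ x ⁆)

E : ∀ {n} → 4 ≤ n → Subset n → Subset n → Family n
E h A B =
  X A B (e 0) (e 1) ∷ X A B (e 0) (e 2) ∷ X A B (e 0) (e 3) ∷
  X A B (e 1) (e 2) ∷ X A B (e 1) (e 3) ∷ X A B (e 2) (e 3) ∷ []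
  where
    e : ℕ → Fin _
    e 0 = el h zero
    e 1 = el h (suc zero)
    e 2 = el h (suc (suc zero))
    e _ = el h (suc (suc (suc zero)))

_∩ᶠ_ : ∀ {n} → Family n → Family n → Family n
𝓟 ∩ᶠ 𝓠 = filter (_∈? 𝓠) 𝓟

DiffIs : ∀ {n} → Subset n → Subset n → (Fin n → Set) → Set
DiffIs {n} A B S = ∀ (x : Fin n) → ((x ∈ₛ A × x ∉ₛ B) ⇔ S x)

{-# OPTIONS --safe #-}
module Submission where

-- Write I = A ∩ B. As A ∖ B = {1,2} and B ∖ A = {3,4}, |I| = t - 1 and A, B are I plus two of
-- the four points 1,2,3,4. If a (t+1)-set G meets A and B in at least t points each, then
-- 2t ≤ |G ∩ A| + |G ∩ B| = |G ∩ (A ∪ B)| + |G ∩ I| ≤ |G| + |I| = 2t, so I ⊆ G ⊆ A ∪ B and G is I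
-- plus two of the four points, i.e. G ∈ 𝓔. This gives (i), and |𝓕 ∩ 𝓔| ≤ |𝓔| = 6.
-- For the lower bound count over 𝓕: by (i) each member lies in 𝓔 or in D(A) ∪ D(B), and A, B lie in
-- both, so |𝓕| + |D| + 2 ≤ |𝓕 ∩ 𝓔| + |D(A)| + |D(B)| ≤ |𝓕 ∩ 𝓔| + 2s. Finally |𝓕| ≥ 2s + 3 by
-- maximality: the 2-sets {a,b}, {a,cᵢ}, {b,cᵢ} (0 ≤ i ≤ s) on s + 3 points, each enlarged by a
-- common (t-1)-set, form an admissible family of that size.

open import Defs hiding (_∈_; _∉_)
open import Data.Nat using (ℕ; zero; suc; _+_; _*_; _∸_; _≤_; _<_; _<?_; z≤n; s≤s)
open import Data.Nat.Properties
open import Data.Nat.ListAction using (sum)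
open import Data.Nat.Tactic.RingSolver using (solve-∀)
open import Data.Fin using (Fin; zero; suc)
open import Data.Fin.Patterns using (0F; 1F; 2F; 3F)
open import Data.Fin.Properties using (all?; inject≤-injective) renaming (_≟_ to _≟ᶠ_)
open import Data.Fin.Subset
  using (Subset; inside; outside; _∩_; _∪_; _─_; ⁅_⁆; ⊥; ∣_∣; _⊆_)
  renaming (_∈_ to _∈ₛ_; _∉_ to _∉ₛ_)
open import Data.Fin.Subset.Properties
  using ( ⊆-antisym; p⊆q⇒∣p∣≤∣q∣; p⊂q⇒∣p∣<∣q∣; ∣⊥∣≡0; ∣⁅x⁆∣≡1; ∣p∣≤∣x∷p∣
        ; x∈⁅x⁆; x∈⁅y⁆⇒x≡y; x∈p∩q⁺; x∈p∩q⁻; x∈p∪q⁺; x∈p∪q⁻; p∩q⊆p; p∩q⊆q; p─q⊆p; x∈p∧x∉q⇒x∈p─q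
        ; ∩-comm; ∩-zeroˡ; ∪-comm; ∪-identityˡ; ∪-identityʳ)
  renaming (_∈?_ to _∈ₛ?_)
open import Data.Vec using (_∷_; []; here; there) renaming (_++_ to _++ᵥ_)
open import Data.Vec.Properties using (++-injectiveʳ; ∷-injectiveʳ)
open import Data.List using (List; []; _∷_; _++_; length; filter; map; tabulate)
open import Data.List.Properties
  using ( map-cong-local; length-++; length-map; length-tabulate
        ; filter-++; filter-none; filter-notAll; filter-reject; filter-≐)
open import Data.List.Membership.Propositional using (_∈_; _∉_)
open import Data.List.Membership.Propositional.Properties
  using (∈-∃++; ∈-++⁻; ∈-++⁺ˡ; ∈-++⁺ʳ; ∈-length; ∈-map⁺; ∈-map⁻; ∈-filter⁺; ∈-filter⁻; ∈-tabulate⁺; ∈-tabulate⁻)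
open import Data.List.Relation.Unary.Any using (here; there; any?)
open import Data.List.Relation.Unary.Any.Properties using () renaming (tabulate⁺ to Any-tabulate⁺)
open import Data.List.Relation.Unary.All as All using (_∷_)
open import Data.List.Relation.Unary.All.Properties using () renaming (++⁺ to All-++⁺; tabulate⁺ to All-tabulate⁺)
open import Data.List.Relation.Unary.AllPairs using (_∷_)
open import Data.List.Relation.Unary.Unique.Propositional using (Unique)
import Data.List.Relation.Unary.Unique.Propositional.Properties as Unique
open import Data.List.Relation.Binary.Sublist.Propositional using (⊆-refl)
open import Data.List.Relation.Binary.Sublist.Propositional.Properties using (length-mono-≤; filter⁺)
open import Data.Product using (Σ-syntax; ∃; ∃₂; _×_; _,_; proj₁; proj₂)
open import Data.Product.Properties using () renaming (≡-dec to ×-≡-dec)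
open import Data.Sum using (_⊎_; inj₁; inj₂; [_,_]′)
import Data.Sum as Sum
open import Function using (_∘_; _⇔_; Equivalence; mk⇔)
open import Relation.Nullary using (Dec; yes; no; ¬_; ¬?; contradiction; _⊎-dec_; _→-dec_)
open import Relation.Nullary.Decidable using (toWitness)
open import Relation.Unary using (Pred; Decidable)
open import Relation.Unary.Properties using (_∩?_; _∪?_)
open import Relation.Binary.PropositionalEquality
open import Algebra.Properties.CommutativeSemigroup +-commutativeSemigroup using (interchange)

-- Counting in lists

module _ {a} {A : Set a} where

  𝟙 : ∀ {p} {P : Set p} → Dec P → ℕ
  𝟙 (yes _) = 1
  𝟙 (no  _) = 0

  sum-map-+ : ∀ (f g : A → ℕ) xs → sum (map (λ x → f x + g x) xs) ≡ sum (map f xs) + sum (map g xs)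
  sum-map-+ f g []       = refl
  sum-map-+ f g (x ∷ xs) = trans (cong (f x + g x +_) (sum-map-+ f g xs)) (interchange (f x) (g x) _ _)

  sum-map-+₃ : ∀ (f g h : A → ℕ) xs →
               sum (map (λ x → f x + g x + h x) xs) ≡ sum (map f xs) + sum (map g xs) + sum (map h xs)
  sum-map-+₃ f g h xs = trans (sum-map-+ (λ x → f x + g x) h xs) (cong (_+ _) (sum-map-+ f g xs))

  length≡sum-map-1 : ∀ (xs : List A) → length xs ≡ sum (map (λ _ → 1) xs)
  length≡sum-map-1 []       = refl
  length≡sum-map-1 (_ ∷ xs) = cong suc (length≡sum-map-1 xs)

  length-filter≡sum-𝟙 : ∀ {p} {P : Pred A p} (P? : Decidable P) xs → length (filter P? xs) ≡ sum (map (𝟙 ∘ P?) xs)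
  length-filter≡sum-𝟙 P? []       = refl
  length-filter≡sum-𝟙 P? (x ∷ xs) with P? x
  ... | yes _ = cong suc (length-filter≡sum-𝟙 P? xs)
  ... | no  _ = length-filter≡sum-𝟙 P? xs

  Unique∧⊆⇒length≤ : ∀ {xs ys : List A} → Unique xs → (∀ {x} → x ∈ xs → x ∈ ys) → length xs ≤ length ys
  Unique∧⊆⇒length≤ {[]}     _            _     = z≤n
  Unique∧⊆⇒length≤ {x ∷ xs} (x∉xs ∷ uxs) xs⊆ys with ys₁ , ys₂ , refl ← ∈-∃++ (xs⊆ys (here refl)) = begin
    suc (length xs)                ≤⟨ s≤s (Unique∧⊆⇒length≤ uxs xs⊆ys₁++ys₂) ⟩
    suc (length (ys₁ ++ ys₂))      ≡⟨ cong suc (length-++ ys₁) ⟩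
    suc (length ys₁ + length ys₂)  ≡⟨ +-suc (length ys₁) (length ys₂) ⟨
    length ys₁ + suc (length ys₂)  ≡⟨ length-++ ys₁ ⟨
    length (ys₁ ++ x ∷ ys₂)        ∎
    where
    open ≤-Reasoning
    xs⊆ys₁++ys₂ : ∀ {y} → y ∈ xs → y ∈ ys₁ ++ ys₂
    xs⊆ys₁++ys₂ y∈xs with ∈-++⁻ ys₁ (xs⊆ys (there y∈xs))
    ... | inj₁ y∈ys₁         = ∈-++⁺ˡ y∈ys₁
    ... | inj₂ (here refl)   = contradiction refl (All.lookup x∉xs y∈xs)
    ... | inj₂ (there y∈ys₂) = ∈-++⁺ʳ ys₁ y∈ys₂

  ∈∧∈∧≢⇒2≤length : ∀ {x y} {xs : List A} → x ∈ xs → y ∈ xs → x ≢ y → 2 ≤ length xs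
  ∈∧∈∧≢⇒2≤length (here refl)  (here refl)  x≢y = contradiction refl x≢y
  ∈∧∈∧≢⇒2≤length (here refl)  (there y∈xs) _   = s≤s (∈-length y∈xs)
  ∈∧∈∧≢⇒2≤length (there x∈xs) (here refl)  _   = s≤s (∈-length x∈xs)
  ∈∧∈∧≢⇒2≤length (there x∈xs) (there y∈xs) x≢y = m≤n⇒m≤1+n (∈∧∈∧≢⇒2≤length x∈xs y∈xs x≢y)

  module _ {p} {P : Pred A p} (P? : Decidable P) where

    length-filter-++ : ∀ xs ys → length (filter P? (xs ++ ys)) ≡ length (filter P? xs) + length (filter P? ys)
    length-filter-++ xs ys = trans (cong length (filter-++ P? xs ys)) (length-++ (filter P? xs))

    length-filter-map : ∀ {b} {B : Set b} (f : B → A) xs →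
                        length (filter P? (map f xs)) ≡ length (filter (P? ∘ f) xs)
    length-filter-map f []       = refl
    length-filter-map f (x ∷ xs) with P? (f x)
    ... | yes _ = cong suc (length-filter-map f xs)
    ... | no  _ = length-filter-map f xs

    module _ {q} {Q : Pred A q} (Q? : Decidable Q) where

      filter-filter : ∀ xs → filter Q? (filter P? xs) ≡ filter (P? ∩? Q?) xs
      filter-filter []       = refl
      filter-filter (x ∷ xs) with P? x
      ... | no  _ = filter-filter xs
      ... | yes _ with Q? x
      ...   | yes _ = cong (x ∷_) (filter-filter xs)
      ...   | no  _ = filter-filter xs

      module _ {r} {R : Pred A r} (R? : Decidable R) where

        𝟙-cover : ∀ x → (¬ P x → ¬ Q x → R x) →
                  1 + 𝟙 ((P? ∩? Q?) x) + 𝟙 ((R? ∩? (P? ∪? Q?)) x) ≡ 𝟙 (R? x) + 𝟙 (P? x) + 𝟙 (Q? x)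
        𝟙-cover x cover with P? x | Q? x | R? x
        ... | yes _ | yes _ | yes _ = refl
        ... | yes _ | yes _ | no  _ = refl
        ... | yes _ | no  _ | yes _ = refl
        ... | yes _ | no  _ | no  _ = refl
        ... | no  _ | yes _ | yes _ = refl
        ... | no  _ | yes _ | no  _ = refl
        ... | no  _ | no  _ | yes _ = refl
        ... | no ¬p | no ¬q | no ¬r = contradiction (cover ¬p ¬q) ¬r

        length-filter-cover : ∀ xs → (∀ {x} → x ∈ xs → ¬ P x → ¬ Q x → R x) →
          length xs + length (filter (P? ∩? Q?) xs) + length (filter (R? ∩? (P? ∪? Q?)) xs)
            ≡ length (filter R? xs) + length (filter P? xs) + length (filter Q? xs)
        length-filter-cover xs cover = begin
          length xs + length (filter (P? ∩? Q?) xs) + length (filter (R? ∩? (P? ∪? Q?)) xs)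
            ≡⟨ cong₂ _+_ (cong₂ _+_ (length≡sum-map-1 xs) (length-filter≡sum-𝟙 (P? ∩? Q?) xs))
                         (length-filter≡sum-𝟙 (R? ∩? (P? ∪? Q?)) xs) ⟩
          sum (map (λ _ → 1) xs) + sum (map (𝟙 ∘ (P? ∩? Q?)) xs) + sum (map (𝟙 ∘ (R? ∩? (P? ∪? Q?))) xs)
            ≡⟨ sum-map-+₃ (λ _ → 1) (𝟙 ∘ (P? ∩? Q?)) (𝟙 ∘ (R? ∩? (P? ∪? Q?))) xs ⟨
          sum (map (λ x → 1 + 𝟙 ((P? ∩? Q?) x) + 𝟙 ((R? ∩? (P? ∪? Q?)) x)) xs)
            ≡⟨ cong sum (map-cong-local (All.tabulate (λ {x} x∈xs → 𝟙-cover x (cover x∈xs)))) ⟩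
          sum (map (λ x → 𝟙 (R? x) + 𝟙 (P? x) + 𝟙 (Q? x)) xs)
            ≡⟨ sum-map-+₃ (𝟙 ∘ R?) (𝟙 ∘ P?) (𝟙 ∘ Q?) xs ⟩
          sum (map (𝟙 ∘ R?) xs) + sum (map (𝟙 ∘ P?) xs) + sum (map (𝟙 ∘ Q?) xs)
            ≡⟨ cong₂ _+_ (cong₂ _+_ (length-filter≡sum-𝟙 R? xs) (length-filter≡sum-𝟙 P? xs))
                         (length-filter≡sum-𝟙 Q? xs) ⟨
          length (filter R? xs) + length (filter P? xs) + length (filter Q? xs) ∎
          where open ≡-Reasoning

-- Subsets and their sizes

x∈p⇒0<∣p∣ : ∀ {n x} {p : Subset n} → x ∈ₛ p → 0 < ∣ p ∣
x∈p⇒0<∣p∣ here                    = s≤s z≤n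
x∈p⇒0<∣p∣ {p = b ∷ p} (there x∈p) = ≤-trans (x∈p⇒0<∣p∣ x∈p) (∣p∣≤∣x∷p∣ b p)

x∈p∧x∈q⇒¬∣p∩q∣<1 : ∀ {n x} (p q : Subset n) → x ∈ₛ p → x ∈ₛ q → ¬ ∣ p ∩ q ∣ < 1
x∈p∧x∈q⇒¬∣p∩q∣<1 _ _ x∈p x∈q = ≤⇒≯ (x∈p⇒0<∣p∣ (x∈p∩q⁺ (x∈p , x∈q)))

x∈p─q⇒x∉q : ∀ {n x} {p q : Subset n} → x ∈ₛ p ─ q → x ∉ₛ q
x∈p─q⇒x∉q {p = _ ∷ _} {outside ∷ _} here           ()
x∈p─q⇒x∉q {p = _ ∷ _} {_       ∷ _} (there x∈p─q) (there x∈q) = x∈p─q⇒x∉q x∈p─q x∈q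

x∈p─q⇔ : ∀ {n x} {p q : Subset n} → x ∈ₛ p ─ q ⇔ (x ∈ₛ p × x ∉ₛ q)
x∈p─q⇔ {p = p} {q} = mk⇔ (λ x∈ → p─q⊆p p q x∈ , x∈p─q⇒x∉q x∈) (λ (x∈p , x∉q) → x∈p∧x∉q⇒x∈p─q x∈p x∉q)

x∈⁅y⁆∪⁅z⁆⇔ : ∀ {n} {x y z : Fin n} → x ∈ₛ ⁅ y ⁆ ∪ ⁅ z ⁆ ⇔ (x ≡ y ⊎ x ≡ z)
x∈⁅y⁆∪⁅z⁆⇔ {y = y} {z} = mk⇔
  (Sum.map (x∈⁅y⁆⇒x≡y y) (x∈⁅y⁆⇒x≡y z) ∘ x∈p∪q⁻ ⁅ y ⁆ ⁅ z ⁆)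
  (x∈p∪q⁺ ∘ Sum.map (λ { refl → x∈⁅x⁆ y }) (λ { refl → x∈⁅x⁆ z }))

⁅x⁆≡⁅y⁆⇒x≡y : ∀ {n} {x y : Fin n} → ⁅ x ⁆ ≡ ⁅ y ⁆ → x ≡ y
⁅x⁆≡⁅y⁆⇒x≡y {x = x} {y} eq = x∈⁅y⁆⇒x≡y y (subst (x ∈ₛ_) eq (x∈⁅x⁆ x))

p⊆q∧∣q∣≤∣p∣⇒q⊆p : ∀ {n} {p q : Subset n} → p ⊆ q → ∣ q ∣ ≤ ∣ p ∣ → q ⊆ p
p⊆q∧∣q∣≤∣p∣⇒q⊆p {p = p} p⊆q ∣q∣≤∣p∣ {x} x∈q with x ∈ₛ? p
... | yes x∈p = x∈p
... | no  x∉p = contradiction (p⊂q⇒∣p∣<∣q∣ (p⊆q , x , x∈q , x∉p)) (≤⇒≯ ∣q∣≤∣p∣)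

q⊆p⇒p∩q≡q : ∀ {n} {p q : Subset n} → q ⊆ p → p ∩ q ≡ q
q⊆p⇒p∩q≡q {p = p} {q} q⊆p = ⊆-antisym (p∩q⊆q p q) (λ x∈q → x∈p∩q⁺ (q⊆p x∈q , x∈q))

p≡[p∩q]∪[p─q] : ∀ {n} (p q : Subset n) → p ≡ (p ∩ q) ∪ (p ─ q)
p≡[p∩q]∪[p─q] []            []            = refl
p≡[p∩q]∪[p─q] (inside  ∷ p) (inside  ∷ q) = cong (inside ∷_)  (p≡[p∩q]∪[p─q] p q)
p≡[p∩q]∪[p─q] (inside  ∷ p) (outside ∷ q) = cong (inside ∷_)  (p≡[p∩q]∪[p─q] p q)
p≡[p∩q]∪[p─q] (outside ∷ p) (inside  ∷ q) = cong (outside ∷_) (p≡[p∩q]∪[p─q] p q)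
p≡[p∩q]∪[p─q] (outside ∷ p) (outside ∷ q) = cong (outside ∷_) (p≡[p∩q]∪[p─q] p q)

∣p∣≡∣p∩q∣+∣p─q∣ : ∀ {n} (p q : Subset n) → ∣ p ∣ ≡ ∣ p ∩ q ∣ + ∣ p ─ q ∣
∣p∣≡∣p∩q∣+∣p─q∣ []            []            = refl
∣p∣≡∣p∩q∣+∣p─q∣ (inside  ∷ p) (inside  ∷ q) = cong suc (∣p∣≡∣p∩q∣+∣p─q∣ p q)
∣p∣≡∣p∩q∣+∣p─q∣ (inside  ∷ p) (outside ∷ q) = trans (cong suc (∣p∣≡∣p∩q∣+∣p─q∣ p q)) (sym (+-suc _ _))
∣p∣≡∣p∩q∣+∣p─q∣ (outside ∷ p) (inside  ∷ q) = ∣p∣≡∣p∩q∣+∣p─q∣ p q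
∣p∣≡∣p∩q∣+∣p─q∣ (outside ∷ p) (outside ∷ q) = ∣p∣≡∣p∩q∣+∣p─q∣ p q

∣p∪q∣+∣p∩q∣≡∣p∣+∣q∣ : ∀ {n} (p q : Subset n) → ∣ p ∪ q ∣ + ∣ p ∩ q ∣ ≡ ∣ p ∣ + ∣ q ∣
∣p∪q∣+∣p∩q∣≡∣p∣+∣q∣ []            []            = refl
∣p∪q∣+∣p∩q∣≡∣p∣+∣q∣ (inside  ∷ p) (inside  ∷ q) = cong suc (begin
  ∣ p ∪ q ∣ + suc ∣ p ∩ q ∣    ≡⟨ +-suc _ _ ⟩
  suc (∣ p ∪ q ∣ + ∣ p ∩ q ∣)  ≡⟨ cong suc (∣p∪q∣+∣p∩q∣≡∣p∣+∣q∣ p q) ⟩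
  suc (∣ p ∣ + ∣ q ∣)          ≡⟨ +-suc _ _ ⟨
  ∣ p ∣ + suc ∣ q ∣            ∎)
  where open ≡-Reasoning
∣p∪q∣+∣p∩q∣≡∣p∣+∣q∣ (inside  ∷ p) (outside ∷ q) = cong suc (∣p∪q∣+∣p∩q∣≡∣p∣+∣q∣ p q)
∣p∪q∣+∣p∩q∣≡∣p∣+∣q∣ (outside ∷ p) (inside  ∷ q) = trans (cong suc (∣p∪q∣+∣p∩q∣≡∣p∣+∣q∣ p q)) (sym (+-suc _ _))
∣p∪q∣+∣p∩q∣≡∣p∣+∣q∣ (outside ∷ p) (outside ∷ q) = ∣p∪q∣+∣p∩q∣≡∣p∣+∣q∣ p q

∣⁅x⁆∪⁅y⁆∣≡2 : ∀ {n} {x y : Fin n} → x ≢ y → ∣ ⁅ x ⁆ ∪ ⁅ y ⁆ ∣ ≡ 2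
∣⁅x⁆∪⁅y⁆∣≡2 {x = zero}  {zero}  x≢y = contradiction refl x≢y
∣⁅x⁆∪⁅y⁆∣≡2 {x = zero}  {suc y} _   = cong suc (trans (cong ∣_∣ (∪-identityˡ ⁅ y ⁆)) (∣⁅x⁆∣≡1 y))
∣⁅x⁆∪⁅y⁆∣≡2 {x = suc x} {zero}  _   = cong suc (trans (cong ∣_∣ (∪-identityʳ ⁅ x ⁆)) (∣⁅x⁆∣≡1 x))
∣⁅x⁆∪⁅y⁆∣≡2 {x = suc x} {suc y} x≢y = ∣⁅x⁆∪⁅y⁆∣≡2 (x≢y ∘ cong suc)

∣p∣≡0⇒p≡⊥ : ∀ {n} (p : Subset n) → ∣ p ∣ ≡ 0 → p ≡ ⊥
∣p∣≡0⇒p≡⊥ []            _  = refl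
∣p∣≡0⇒p≡⊥ (outside ∷ p) eq = cong (outside ∷_) (∣p∣≡0⇒p≡⊥ p eq)

∣p∣≡1⇒p≡⁅x⁆ : ∀ {n} (p : Subset n) → ∣ p ∣ ≡ 1 → ∃ λ x → p ≡ ⁅ x ⁆
∣p∣≡1⇒p≡⁅x⁆ (inside  ∷ p) eq = zero , cong (inside ∷_) (∣p∣≡0⇒p≡⊥ p (suc-injective eq))
∣p∣≡1⇒p≡⁅x⁆ (outside ∷ p) eq with x , refl ← ∣p∣≡1⇒p≡⁅x⁆ p eq = suc x , refl

∣p∣≡2⇒p≡⁅x⁆∪⁅y⁆ : ∀ {n} (p : Subset n) → ∣ p ∣ ≡ 2 → ∃₂ λ x y → x ≢ y × p ≡ ⁅ x ⁆ ∪ ⁅ y ⁆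
∣p∣≡2⇒p≡⁅x⁆∪⁅y⁆ (inside  ∷ p) eq with y , refl ← ∣p∣≡1⇒p≡⁅x⁆ p (suc-injective eq) =
  zero , suc y , (λ ()) , cong (inside ∷_) (sym (∪-identityˡ ⁅ y ⁆))
∣p∣≡2⇒p≡⁅x⁆∪⁅y⁆ (outside ∷ p) eq with x , y , x≢y , refl ← ∣p∣≡2⇒p≡⁅x⁆∪⁅y⁆ p eq =
  suc x , suc y , (λ { refl → x≢y refl }) , refl

∣v++p∣≡∣v∣+∣p∣ : ∀ {j m} (v : Subset j) (p : Subset m) → ∣ v ++ᵥ p ∣ ≡ ∣ v ∣ + ∣ p ∣
∣v++p∣≡∣v∣+∣p∣ []            p = refl
∣v++p∣≡∣v∣+∣p∣ (inside  ∷ v) p = cong suc (∣v++p∣≡∣v∣+∣p∣ v p)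
∣v++p∣≡∣v∣+∣p∣ (outside ∷ v) p = ∣v++p∣≡∣v∣+∣p∣ v p

∣[v++p]∩[v++q]∣≡∣v∣+∣p∩q∣ : ∀ {j m} (v : Subset j) (p q : Subset m) →
                            ∣ (v ++ᵥ p) ∩ (v ++ᵥ q) ∣ ≡ ∣ v ∣ + ∣ p ∩ q ∣
∣[v++p]∩[v++q]∣≡∣v∣+∣p∩q∣ []            p q = refl
∣[v++p]∩[v++q]∣≡∣v∣+∣p∩q∣ (inside  ∷ v) p q = cong suc (∣[v++p]∩[v++q]∣≡∣v∣+∣p∩q∣ v p q)
∣[v++p]∩[v++q]∣≡∣v∣+∣p∩q∣ (outside ∷ v) p q = ∣[v++p]∩[v++q]∣≡∣v∣+∣p∩q∣ v p q

subset-of-size : ∀ {j k} → k ≤ j → Σ[ v ∈ Subset j ] ∣ v ∣ ≡ k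
subset-of-size {j} z≤n       = ⊥ , ∣⊥∣≡0 j
subset-of-size     (s≤s k≤j) with v , refl ← subset-of-size k≤j = inside ∷ v , refl

q⊆p∧∣p∣≡2+∣q∣⇒p─q≡⁅x⁆∪⁅y⁆ : ∀ {n} {p q : Subset n} → q ⊆ p → ∣ p ∣ ≡ 2 + ∣ q ∣ →
                             ∃₂ λ x y → x ≢ y × p ─ q ≡ ⁅ x ⁆ ∪ ⁅ y ⁆
q⊆p∧∣p∣≡2+∣q∣⇒p─q≡⁅x⁆∪⁅y⁆ {p = p} {q} q⊆p ∣p∣≡2+∣q∣ = ∣p∣≡2⇒p≡⁅x⁆∪⁅y⁆ (p ─ q) (+-cancelˡ-≡ ∣ q ∣ _ _ (begin
  ∣ q ∣ + ∣ p ─ q ∣      ≡⟨ cong (λ r → ∣ r ∣ + ∣ p ─ q ∣) (q⊆p⇒p∩q≡q q⊆p) ⟨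
  ∣ p ∩ q ∣ + ∣ p ─ q ∣  ≡⟨ ∣p∣≡∣p∩q∣+∣p─q∣ p q ⟨
  ∣ p ∣                  ≡⟨ trans ∣p∣≡2+∣q∣ (+-comm 2 ∣ q ∣) ⟩
  ∣ q ∣ + 2              ∎))
  where open ≡-Reasoning

DiffIs⇒p─q≡⁅a⁆∪⁅b⁆ : ∀ {n} {p q : Subset n} {a b} → DiffIs p q (λ x → x ≡ a ⊎ x ≡ b) → p ─ q ≡ ⁅ a ⁆ ∪ ⁅ b ⁆
DiffIs⇒p─q≡⁅a⁆∪⁅b⁆ p─q⇔ = ⊆-antisym
  (λ x∈ → from x∈⁅y⁆∪⁅z⁆⇔ (to (p─q⇔ _) (to x∈p─q⇔ x∈)))
  (λ x∈ → from x∈p─q⇔ (from (p─q⇔ _) (to x∈⁅y⁆∪⁅z⁆⇔ x∈)))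
  where open Equivalence

≤-squeeze : ∀ {a b c d} → a ≤ c → b ≤ d → c + d ≤ a + b → c ≤ a × d ≤ b
≤-squeeze {a} {b} {c} {d} a≤c b≤d c+d≤a+b =
  +-cancelʳ-≤ d c a (≤-trans c+d≤a+b (+-monoʳ-≤ a b≤d)) ,
  +-cancelˡ-≤ c d b (≤-trans c+d≤a+b (+-monoˡ-≤ b a≤c))

A∩B⊆G⊆A∪B : ∀ {n} {A B G : Subset n} → ∣ G ∣ ≡ 2 + ∣ A ∩ B ∣ →
            suc ∣ A ∩ B ∣ ≤ ∣ G ∩ A ∣ → suc ∣ A ∩ B ∣ ≤ ∣ G ∩ B ∣ → A ∩ B ⊆ G × G ⊆ A ∪ B
A∩B⊆G⊆A∪B {A = A} {B} {G} ∣G∣≡2+∣A∩B∣ ∣G∩A∣> ∣G∩B∣> = A∩B⊆G , G⊆A∪B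
  where
  GA∪GB⊆G : (G ∩ A) ∪ (G ∩ B) ⊆ G
  GA∪GB⊆G x∈ = [ proj₁ ∘ x∈p∩q⁻ G A , proj₁ ∘ x∈p∩q⁻ G B ]′ (x∈p∪q⁻ _ _ x∈)

  GA∩GB⊆A∩B : (G ∩ A) ∩ (G ∩ B) ⊆ A ∩ B
  GA∩GB⊆A∩B x∈ with x∈GA , x∈GB ← x∈p∩q⁻ _ _ x∈ =
    x∈p∩q⁺ (proj₂ (x∈p∩q⁻ G A x∈GA) , proj₂ (x∈p∩q⁻ G B x∈GB))

  tight : ∣ G ∣ ≤ ∣ (G ∩ A) ∪ (G ∩ B) ∣ × ∣ A ∩ B ∣ ≤ ∣ (G ∩ A) ∩ (G ∩ B) ∣
  tight = ≤-squeeze (p⊆q⇒∣p∣≤∣q∣ GA∪GB⊆G) (p⊆q⇒∣p∣≤∣q∣ GA∩GB⊆A∩B) (begin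
    ∣ G ∣ + ∣ A ∩ B ∣                              ≡⟨ cong (_+ ∣ A ∩ B ∣) ∣G∣≡2+∣A∩B∣ ⟩
    suc (suc (∣ A ∩ B ∣ + ∣ A ∩ B ∣))              ≡⟨ cong suc (+-suc ∣ A ∩ B ∣ ∣ A ∩ B ∣) ⟨
    suc ∣ A ∩ B ∣ + suc ∣ A ∩ B ∣                  ≤⟨ +-mono-≤ ∣G∩A∣> ∣G∩B∣> ⟩
    ∣ G ∩ A ∣ + ∣ G ∩ B ∣                          ≡⟨ ∣p∪q∣+∣p∩q∣≡∣p∣+∣q∣ (G ∩ A) (G ∩ B) ⟨
    ∣ (G ∩ A) ∪ (G ∩ B) ∣ + ∣ (G ∩ A) ∩ (G ∩ B) ∣  ∎)
    where open ≤-Reasoning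

  A∩B⊆G : A ∩ B ⊆ G
  A∩B⊆G x∈ = p∩q⊆p G A (p∩q⊆p _ _ (p⊆q∧∣q∣≤∣p∣⇒q⊆p GA∩GB⊆A∩B (proj₂ tight) x∈))

  G⊆A∪B : G ⊆ A ∪ B
  G⊆A∪B x∈ = x∈p∪q⁺ (Sum.map (p∩q⊆q G A) (p∩q⊆q G B) (x∈p∪q⁻ _ _ (p⊆q∧∣q∣≤∣p∣⇒q⊆p GA∪GB⊆G (proj₁ tight) x∈)))

-- The six sets X_{i,x}

X≡A∩B∪⁅i⁆∪⁅x⁆ : ∀ {n} {A B : Subset n} {i x} → x ∉ₛ A ∩ B → X A B i x ≡ (A ∩ B) ∪ (⁅ i ⁆ ∪ ⁅ x ⁆)
X≡A∩B∪⁅i⁆∪⁅x⁆ {A = A} {B} {x = x} x∉A∩B with x ∈ₛ? A ∩ B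
... | yes x∈A∩B = contradiction x∈A∩B x∉A∩B
... | no  _     = refl

ordered-pairs : List (Fin 4 × Fin 4)
ordered-pairs = (0F , 1F) ∷ (0F , 2F) ∷ (0F , 3F) ∷ (1F , 2F) ∷ (1F , 3F) ∷ (2F , 3F) ∷ []

ordered-pairs-complete : ∀ i j → i ≢ j → (i , j) ∈ ordered-pairs ⊎ (j , i) ∈ ordered-pairs
ordered-pairs-complete =
  toWitness {a? = all? λ i → all? λ j → ¬? (i ≟ᶠ j) →-dec (listed? (i , j) ⊎-dec listed? (j , i))} _
  where
  listed? : ∀ ij → Dec (ij ∈ ordered-pairs)
  listed? ij = any? (×-≡-dec _≟ᶠ_ _≟ᶠ_ ij) ordered-pairs

module Configuration {n} (h : 4 ≤ n) {A B : Subset n}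
  (A─B : DiffIs A B (λ x → x ≡ el h 0F ⊎ x ≡ el h 1F))
  (B─A : DiffIs B A (λ x → x ≡ el h 2F ⊎ x ≡ el h 3F)) where

  open Equivalence

  e : Fin 4 → Fin n
  e = el h

  ∣A∣≡2+∣A∩B∣ : ∣ A ∣ ≡ 2 + ∣ A ∩ B ∣
  ∣A∣≡2+∣A∩B∣ = begin
    ∣ A ∣                                ≡⟨ ∣p∣≡∣p∩q∣+∣p─q∣ A B ⟩
    ∣ A ∩ B ∣ + ∣ A ─ B ∣                ≡⟨ cong (λ p → ∣ A ∩ B ∣ + ∣ p ∣) (DiffIs⇒p─q≡⁅a⁆∪⁅b⁆ A─B) ⟩
    ∣ A ∩ B ∣ + ∣ ⁅ e 0F ⁆ ∪ ⁅ e 1F ⁆ ∣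
      ≡⟨ cong (∣ A ∩ B ∣ +_) (∣⁅x⁆∪⁅y⁆∣≡2 (0F≢1F ∘ inject≤-injective h h 0F 1F)) ⟩
    ∣ A ∩ B ∣ + 2                        ≡⟨ +-comm ∣ A ∩ B ∣ 2 ⟩
    2 + ∣ A ∩ B ∣                        ∎
    where
    open ≡-Reasoning
    0F≢1F : 0F ≢ 1F
    0F≢1F ()

  A≢B : A ≢ B
  A≢B A≡B with e0∈A , e0∉B ← from (A─B (e 0F)) (inj₁ refl) = e0∉B (subst (e 0F ∈ₛ_) A≡B e0∈A)

  e∉A∩B : ∀ i → e i ∉ₛ A ∩ B
  e∉A∩B 0F = proj₂ (from (A─B _) (inj₁ refl)) ∘ proj₂ ∘ x∈p∩q⁻ A B
  e∉A∩B 1F = proj₂ (from (A─B _) (inj₂ refl)) ∘ proj₂ ∘ x∈p∩q⁻ A B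
  e∉A∩B 2F = proj₂ (from (B─A _) (inj₁ refl)) ∘ proj₁ ∘ x∈p∩q⁻ A B
  e∉A∩B 3F = proj₂ (from (B─A _) (inj₂ refl)) ∘ proj₁ ∘ x∈p∩q⁻ A B

  A∈E : A ∈ E h A B
  A∈E = here (begin
    A                                ≡⟨ p≡[p∩q]∪[p─q] A B ⟩
    (A ∩ B) ∪ (A ─ B)                ≡⟨ cong (A ∩ B ∪_) (DiffIs⇒p─q≡⁅a⁆∪⁅b⁆ A─B) ⟩
    (A ∩ B) ∪ (⁅ e 0F ⁆ ∪ ⁅ e 1F ⁆)  ≡⟨ X≡A∩B∪⁅i⁆∪⁅x⁆ (e∉A∩B 1F) ⟨
    X A B (e 0F) (e 1F)              ∎)
    where open ≡-Reasoning

  B∈E : B ∈ E h A B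
  B∈E = there (there (there (there (there (here (begin
    B                                ≡⟨ p≡[p∩q]∪[p─q] B A ⟩
    (B ∩ A) ∪ (B ─ A)                ≡⟨ cong₂ _∪_ (∩-comm B A) (DiffIs⇒p─q≡⁅a⁆∪⁅b⁆ B─A) ⟩
    (A ∩ B) ∪ (⁅ e 2F ⁆ ∪ ⁅ e 3F ⁆)  ≡⟨ X≡A∩B∪⁅i⁆∪⁅x⁆ (e∉A∩B 3F) ⟨
    X A B (e 2F) (e 3F)              ∎))))))
    where open ≡-Reasoning

  x∈G─A∩B⇒x≡e : ∀ {G} → G ⊆ A ∪ B → ∀ {x} → x ∈ₛ G ─ A ∩ B → ∃ λ i → x ≡ e i
  x∈G─A∩B⇒x≡e G⊆A∪B {x} x∈G─A∩B
    with x∈G , x∉A∩B ← to x∈p─q⇔ x∈G─A∩B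
    with x ∈ₛ? A | x ∈ₛ? B
  ... | yes x∈A | yes x∈B = contradiction (x∈p∩q⁺ (x∈A , x∈B)) x∉A∩B
  ... | yes x∈A | no  x∉B = [ (0F ,_) , (1F ,_) ]′ (to (A─B x) (x∈A , x∉B))
  ... | no  x∉A | yes x∈B = [ (2F ,_) , (3F ,_) ]′ (to (B─A x) (x∈B , x∉A))
  ... | no  x∉A | no  x∉B = contradiction (x∈p∪q⁻ A B (G⊆A∪B x∈G)) [ x∉A , x∉B ]′

  X-at : Fin 4 × Fin 4 → Subset n
  X-at (i , j) = X A B (e i) (e j)

  -- E h A B is, by definition, map X-at ordered-pairs.
  A∩B∪⁅ei⁆∪⁅ej⁆∈E : ∀ {i j} → i ≢ j → (A ∩ B) ∪ (⁅ e i ⁆ ∪ ⁅ e j ⁆) ∈ E h A B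
  A∩B∪⁅ei⁆∪⁅ej⁆∈E {i} {j} i≢j with ordered-pairs-complete i j i≢j
  ... | inj₁ ij∈ = subst (_∈ E h A B) (X≡A∩B∪⁅i⁆∪⁅x⁆ (e∉A∩B j)) (∈-map⁺ X-at ij∈)
  ... | inj₂ ji∈ = subst (_∈ E h A B) (trans (X≡A∩B∪⁅i⁆∪⁅x⁆ (e∉A∩B i)) (cong (A ∩ B ∪_) (∪-comm _ _)))
                         (∈-map⁺ X-at ji∈)

  ∣G∣≡2+∣A∩B∣⇒G∈E : ∀ {G} → ∣ G ∣ ≡ 2 + ∣ A ∩ B ∣ →
                     suc ∣ A ∩ B ∣ ≤ ∣ G ∩ A ∣ → suc ∣ A ∩ B ∣ ≤ ∣ G ∩ B ∣ → G ∈ E h A B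
  ∣G∣≡2+∣A∩B∣⇒G∈E {G} ∣G∣≡2+∣A∩B∣ ∣G∩A∣> ∣G∩B∣>
    with A∩B⊆G , G⊆A∪B ← A∩B⊆G⊆A∪B ∣G∣≡2+∣A∩B∣ ∣G∩A∣> ∣G∩B∣>
    with x , y , x≢y , G─A∩B≡ ← q⊆p∧∣p∣≡2+∣q∣⇒p─q≡⁅x⁆∪⁅y⁆ A∩B⊆G ∣G∣≡2+∣A∩B∣
    with i , refl ← x∈G─A∩B⇒x≡e G⊆A∪B (subst (x ∈ₛ_) (sym G─A∩B≡) (from x∈⁅y⁆∪⁅z⁆⇔ (inj₁ refl)))
    with j , refl ← x∈G─A∩B⇒x≡e G⊆A∪B (subst (y ∈ₛ_) (sym G─A∩B≡) (from x∈⁅y⁆∪⁅z⁆⇔ (inj₂ refl)))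
    = subst (_∈ E h A B) G≡A∩B∪⁅ei⁆∪⁅ej⁆ (A∩B∪⁅ei⁆∪⁅ej⁆∈E (x≢y ∘ cong e))
    where
    G≡A∩B∪⁅ei⁆∪⁅ej⁆ : (A ∩ B) ∪ (⁅ e i ⁆ ∪ ⁅ e j ⁆) ≡ G
    G≡A∩B∪⁅ei⁆∪⁅ej⁆ = sym (trans (p≡[p∩q]∪[p─q] G (A ∩ B)) (cong₂ _∪_ (q⊆p⇒p∩q≡q A∩B⊆G) G─A∩B≡))

  module InFamily {t} {𝓕 : Family n} (uniform : Uniform (suc t) 𝓕) (A∈𝓕 : A ∈ 𝓕) (B∈𝓕 : B ∈ 𝓕) where

    t≡1+∣A∩B∣ : t ≡ suc ∣ A ∩ B ∣
    t≡1+∣A∩B∣ = suc-injective (trans (sym (uniform A A∈𝓕)) ∣A∣≡2+∣A∩B∣)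

    inE? : Decidable (_∈ E h A B)
    inE? = _∈? E h A B

    inDA? : Decidable (λ G → ∣ G ∩ A ∣ < t)
    inDA? G = ∣ G ∩ A ∣ <? t

    inDB? : Decidable (λ G → ∣ G ∩ B ∣ < t)
    inDB? G = ∣ G ∩ B ∣ <? t

    ∉D⇒∈E : ∀ {G} → G ∈ 𝓕 → ¬ ∣ G ∩ A ∣ < t → ¬ ∣ G ∩ B ∣ < t → G ∈ E h A B
    ∉D⇒∈E {G} G∈𝓕 G≮A G≮B = ∣G∣≡2+∣A∩B∣⇒G∈E
      (trans (uniform G G∈𝓕) (cong suc t≡1+∣A∩B∣))
      (subst (_≤ ∣ G ∩ A ∣) t≡1+∣A∩B∣ (≮⇒≥ G≮A))
      (subst (_≤ ∣ G ∩ B ∣) t≡1+∣A∩B∣ (≮⇒≥ G≮B))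

    ∉E⇒∈D : ∀ {G} → G ∈ 𝓕 → G ∉ E h A B → G ∈ D 𝓕 A t ⊎ G ∈ D 𝓕 B t
    ∉E⇒∈D {G} G∈𝓕 G∉E with inDA? G | inDB? G
    ... | yes G<A | _       = inj₁ (∈-filter⁺ inDA? G∈𝓕 G<A)
    ... | no  _   | yes G<B = inj₂ (∈-filter⁺ inDB? G∈𝓕 G<B)
    ... | no  G≮A | no  G≮B = contradiction (∉D⇒∈E G∈𝓕 G≮A G≮B) G∉E

    ∣D∩ᶠD∣≤∣D∩D∣ : length (D 𝓕 A t ∩ᶠ D 𝓕 B t) ≤ length (filter (inDA? ∩? inDB?) 𝓕)
    ∣D∩ᶠD∣≤∣D∩D∣ = begin
      length (filter (_∈? D 𝓕 B t) (D 𝓕 A t))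
        ≤⟨ length-mono-≤ (filter⁺ (_∈? D 𝓕 B t) inDB? in-DB (⊆-refl {x = D 𝓕 A t})) ⟩
      length (filter inDB? (filter inDA? 𝓕))   ≡⟨ cong length (filter-filter inDA? inDB? 𝓕) ⟩
      length (filter (inDA? ∩? inDB?) 𝓕)       ∎
      where
      open ≤-Reasoning
      in-DB : ∀ {G H} → G ≡ H → G ∈ D 𝓕 B t → ∣ H ∩ B ∣ < t
      in-DB refl G∈DB = proj₂ (∈-filter⁻ inDB? {xs = 𝓕} G∈DB)

    2≤∣E∩[D∪D]∣ : 2 ≤ length (filter (inE? ∩? (inDA? ∪? inDB?)) 𝓕)
    2≤∣E∩[D∪D]∣ = ∈∧∈∧≢⇒2≤length
      (∈-filter⁺ (inE? ∩? (inDA? ∪? inDB?)) A∈𝓕 (A∈E , inj₂ ∣A∩B∣<t))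
      (∈-filter⁺ (inE? ∩? (inDA? ∪? inDB?)) B∈𝓕 (B∈E , inj₁ (subst (λ p → ∣ p ∣ < t) (∩-comm A B) ∣A∩B∣<t)))
      A≢B
      where
      ∣A∩B∣<t : ∣ A ∩ B ∣ < t
      ∣A∩B∣<t = ≤-reflexive (sym t≡1+∣A∩B∣)

    double-count : length 𝓕 + length (D 𝓕 A t ∩ᶠ D 𝓕 B t) + 2
                   ≤ length (𝓕 ∩ᶠ E h A B) + length (D 𝓕 A t) + length (D 𝓕 B t)
    double-count = begin
      length 𝓕 + length (D 𝓕 A t ∩ᶠ D 𝓕 B t) + 2
        ≤⟨ +-mono-≤ (+-monoʳ-≤ (length 𝓕) ∣D∩ᶠD∣≤∣D∩D∣) 2≤∣E∩[D∪D]∣ ⟩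
      length 𝓕 + length (filter (inDA? ∩? inDB?) 𝓕) + length (filter (inE? ∩? (inDA? ∪? inDB?)) 𝓕)
        ≡⟨ length-filter-cover inDA? inDB? inE? 𝓕 ∉D⇒∈E ⟩
      length (𝓕 ∩ᶠ E h A B) + length (D 𝓕 A t) + length (D 𝓕 B t) ∎
      where open ≤-Reasoning

-- An admissible family of size 2s + 3

++-admissible : ∀ {j m t s} (v : Subset j) {𝓖 : Family m} →
                Admissible t s 𝓖 → Admissible (∣ v ∣ + t) s (map (v ++ᵥ_) 𝓖)
++-admissible {t = t} {s} v {𝓖} (unique , uniform , almost , ¬intersecting) =
  Unique.map⁺ (++-injectiveʳ v v) unique , uniform′ , almost′ , ¬intersecting ∘ intersecting
  where
  shift : ∀ p q → ∣ (v ++ᵥ p) ∩ (v ++ᵥ q) ∣ ≡ ∣ v ∣ + ∣ p ∩ q ∣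
  shift = ∣[v++p]∩[v++q]∣≡∣v∣+∣p∩q∣ v

  uniform′ : Uniform (suc (∣ v ∣ + t)) (map (v ++ᵥ_) 𝓖)
  uniform′ F F∈ with p , p∈𝓖 , refl ← ∈-map⁻ (v ++ᵥ_) F∈ =
    trans (∣v++p∣≡∣v∣+∣p∣ v p) (trans (cong (∣ v ∣ +_) (uniform p p∈𝓖)) (+-suc ∣ v ∣ t))

  almost′ : AlmostIntersecting s (∣ v ∣ + t) (map (v ++ᵥ_) 𝓖)
  almost′ F F∈ with p , p∈𝓖 , refl ← ∈-map⁻ (v ++ᵥ_) F∈ = begin
    length (D (map (v ++ᵥ_) 𝓖) (v ++ᵥ p) (∣ v ∣ + t))
      ≡⟨ length-filter-map (λ G → ∣ G ∩ (v ++ᵥ p) ∣ <? ∣ v ∣ + t) (v ++ᵥ_) 𝓖 ⟩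
    length (filter (λ q → ∣ (v ++ᵥ q) ∩ (v ++ᵥ p) ∣ <? ∣ v ∣ + t) 𝓖)
      ≡⟨ cong length (filter-≐ _ _ (shifted⇒ , ⇒shifted) 𝓖) ⟩
    length (D 𝓖 p t)
      ≤⟨ almost p p∈𝓖 ⟩
    s ∎
    where
    open ≤-Reasoning
    shifted⇒ : ∀ {q} → ∣ (v ++ᵥ q) ∩ (v ++ᵥ p) ∣ < ∣ v ∣ + t → ∣ q ∩ p ∣ < t
    shifted⇒ {q} lt = +-cancelˡ-< ∣ v ∣ _ _ (subst (_< ∣ v ∣ + t) (shift q p) lt)
    ⇒shifted : ∀ {q} → ∣ q ∩ p ∣ < t → ∣ (v ++ᵥ q) ∩ (v ++ᵥ p) ∣ < ∣ v ∣ + t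
    ⇒shifted {q} lt = subst (_< ∣ v ∣ + t) (sym (shift q p)) (+-monoʳ-< ∣ v ∣ lt)

  intersecting : TIntersecting (∣ v ∣ + t) (map (v ++ᵥ_) 𝓖) → TIntersecting t 𝓖
  intersecting T p q p∈𝓖 q∈𝓖 = +-cancelˡ-≤ ∣ v ∣ _ _
    (subst (∣ v ∣ + t ≤_) (shift p q) (T _ _ (∈-map⁺ (v ++ᵥ_) p∈𝓖) (∈-map⁺ (v ++ᵥ_) q∈𝓖)))

module Star (s : ℕ) where

  ab : Subset (3 + s)
  ab = inside ∷ inside ∷ ⊥

  ac bc : Fin (suc s) → Subset (3 + s)
  ac i = inside  ∷ outside ∷ ⁅ i ⁆
  bc i = outside ∷ inside  ∷ ⁅ i ⁆

  star : Family (3 + s)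
  star = ab ∷ tabulate ac ++ tabulate bc

  data Member : Subset (3 + s) → Set where
    is-ab : Member ab
    is-ac : ∀ i → Member (ac i)
    is-bc : ∀ i → Member (bc i)

  member : ∀ {F} → F ∈ star → Member F
  member (here refl) = is-ab
  member (there F∈) with ∈-++⁻ (tabulate ac) F∈
  ... | inj₁ F∈ac with i , refl ← ∈-tabulate⁻ {f = ac} F∈ac = is-ac i
  ... | inj₂ F∈bc with i , refl ← ∈-tabulate⁻ {f = bc} F∈bc = is-bc i

  length-star : length star ≡ 2 * s + 3
  length-star = begin
    suc (length (tabulate ac ++ tabulate bc))          ≡⟨ cong suc (length-++ (tabulate ac)) ⟩
    suc (length (tabulate ac) + length (tabulate bc))
      ≡⟨ cong suc (cong₂ _+_ (length-tabulate ac) (length-tabulate bc)) ⟩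
    suc (suc s + suc s)                                ≡⟨ arithmetic s ⟩
    2 * s + 3                                          ∎
    where
    open ≡-Reasoning
    arithmetic : ∀ s → suc (suc s + suc s) ≡ 2 * s + 3
    arithmetic = solve-∀

  star-unique : Unique star
  star-unique = All-++⁺ (All-tabulate⁺ {f = ac} λ _ ()) (All-tabulate⁺ {f = bc} λ _ ())
              ∷ Unique.++⁺ (Unique.tabulate⁺ ac-injective) (Unique.tabulate⁺ bc-injective) ac≢bc
    where
    ac-injective : ∀ {i j} → ac i ≡ ac j → i ≡ j
    ac-injective = ⁅x⁆≡⁅y⁆⇒x≡y ∘ ∷-injectiveʳ ∘ ∷-injectiveʳ
    bc-injective : ∀ {i j} → bc i ≡ bc j → i ≡ j
    bc-injective = ⁅x⁆≡⁅y⁆⇒x≡y ∘ ∷-injectiveʳ ∘ ∷-injectiveʳ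
    ac≢bc : ∀ {F} → ¬ (F ∈ tabulate ac × F ∈ tabulate bc)
    ac≢bc (F∈ac , F∈bc) with i , refl ← ∈-tabulate⁻ {f = ac} F∈ac with () ← ∈-tabulate⁻ {f = bc} F∈bc

  star-uniform : Uniform 2 star
  star-uniform F F∈ with member F∈
  ... | is-ab   = cong (2 +_) (∣⊥∣≡0 (suc s))
  ... | is-ac i = cong suc (∣⁅x⁆∣≡1 i)
  ... | is-bc i = cong suc (∣⁅x⁆∣≡1 i)

  disjoint? : (F G : Subset (3 + s)) → Dec (∣ G ∩ F ∣ < 1)
  disjoint? F G = ∣ G ∩ F ∣ <? 1

  c∈ac : ∀ i → suc (suc i) ∈ₛ ac i
  c∈ac i = there (there (x∈⁅x⁆ i))

  c∈bc : ∀ i → suc (suc i) ∈ₛ bc i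
  c∈bc i = there (there (x∈⁅x⁆ i))

  -- Only ac i and bc j with i ≢ j are disjoint, so each member misses at most s others.
  star-almost : AlmostIntersecting s 1 star
  star-almost F F∈ with member F∈
  ... | is-ab = ≤-trans (≤-reflexive (cong length (filter-none (disjoint? ab) (All.tabulate meets-ab)))) z≤n
    where
    meets-ab : ∀ {G} → G ∈ star → ¬ ∣ G ∩ ab ∣ < 1
    meets-ab G∈ with member G∈
    ... | is-ab   = x∈p∧x∈q⇒¬∣p∩q∣<1 ab ab here here
    ... | is-ac i = x∈p∧x∈q⇒¬∣p∩q∣<1 (ac i) ab here here
    ... | is-bc i = x∈p∧x∈q⇒¬∣p∩q∣<1 (bc i) ab (there here) (there here)
  ... | is-ac i = ≤-pred (begin-strict
    length (filter (disjoint? (ac i)) ((ab ∷ tabulate ac) ++ tabulate bc))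
      ≡⟨ length-filter-++ (disjoint? (ac i)) (ab ∷ tabulate ac) (tabulate bc) ⟩
    length (filter (disjoint? (ac i)) (ab ∷ tabulate ac)) + length (filter (disjoint? (ac i)) (tabulate bc))
      ≡⟨ cong (λ l → length l + length (filter (disjoint? (ac i)) (tabulate bc)))
              (filter-none (disjoint? (ac i)) {ab ∷ tabulate ac}
                (x∈p∧x∈q⇒¬∣p∩q∣<1 ab (ac i) here here
                 ∷ All-tabulate⁺ {f = ac} λ j → x∈p∧x∈q⇒¬∣p∩q∣<1 (ac j) (ac i) here here)) ⟩
    length (filter (disjoint? (ac i)) (tabulate bc))
      <⟨ filter-notAll (disjoint? (ac i)) (tabulate bc)
           (Any-tabulate⁺ {f = bc} i (x∈p∧x∈q⇒¬∣p∩q∣<1 (bc i) (ac i) (c∈bc i) (c∈ac i))) ⟩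
    length (tabulate bc)
      ≡⟨ length-tabulate bc ⟩
    suc s ∎)
    where open ≤-Reasoning
  ... | is-bc i = ≤-pred (begin-strict
    length (filter (disjoint? (bc i)) (ab ∷ tabulate ac ++ tabulate bc))
      ≡⟨ cong length (filter-reject (disjoint? (bc i)) {ab} {tabulate ac ++ tabulate bc}
                       (x∈p∧x∈q⇒¬∣p∩q∣<1 ab (bc i) (there here) (there here))) ⟩
    length (filter (disjoint? (bc i)) (tabulate ac ++ tabulate bc))
      ≡⟨ length-filter-++ (disjoint? (bc i)) (tabulate ac) (tabulate bc) ⟩
    length (filter (disjoint? (bc i)) (tabulate ac)) + length (filter (disjoint? (bc i)) (tabulate bc))
      ≡⟨ cong (length (filter (disjoint? (bc i)) (tabulate ac)) +_)
              (cong length (filter-none (disjoint? (bc i))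
                (All-tabulate⁺ {f = bc} λ j → x∈p∧x∈q⇒¬∣p∩q∣<1 (bc j) (bc i) (there here) (there here)))) ⟩
    length (filter (disjoint? (bc i)) (tabulate ac)) + 0
      ≡⟨ +-identityʳ _ ⟩
    length (filter (disjoint? (bc i)) (tabulate ac))
      <⟨ filter-notAll (disjoint? (bc i)) (tabulate ac)
           (Any-tabulate⁺ {f = ac} i (x∈p∧x∈q⇒¬∣p∩q∣<1 (ac i) (bc i) (c∈ac i) (c∈bc i))) ⟩
    length (tabulate ac)
      ≡⟨ length-tabulate ac ⟩
    suc s ∎)
    where open ≤-Reasoning

star-admissible : ∀ s → Admissible 1 (suc s) (Star.star (suc s))
star-admissible s = star-unique , star-uniform , star-almost , ¬intersecting
  where
  open Star (suc s)
  ¬intersecting : ¬ TIntersecting 1 star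
  ¬intersecting T = contradiction
    (subst (1 ≤_) (trans (cong ∣_∣ (∩-zeroˡ {suc (suc s)} ⁅ 0F ⁆)) (∣⊥∣≡0 (suc s)))
      (T (ac 0F) (bc 1F) (there (∈-++⁺ˡ (∈-tabulate⁺ {f = ac} 0F)))
                         (there (∈-++⁺ʳ (tabulate ac) (∈-tabulate⁺ {f = bc} 1F)))))
    λ ()

large-admissible-family : ∀ {n t s} → 1 ≤ t → 1 ≤ s → t + s + 2 ≤ n →
                          Σ[ 𝓖 ∈ Family n ] Admissible t s 𝓖 × 2 * s + 3 ≤ length 𝓖
large-admissible-family {n} {suc k} {suc s} (s≤s z≤n) (s≤s z≤n) t+s+2≤n =
  subst₂ (λ N T → Σ[ 𝓖 ∈ Family N ] Admissible T (suc s) 𝓖 × 2 * suc s + 3 ≤ length 𝓖)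
         (m∸n+n≡m (m+n≤o⇒n≤o k k+[3+s]≤n)) (trans (+-comm ∣ v ∣ 1) (cong suc ∣v∣≡k))
         ( map (v ++ᵥ_) star
         , ++-admissible v (star-admissible s)
         , ≤-reflexive (sym (trans (length-map (v ++ᵥ_) star) length-star)))
  where
  open Star (suc s)
  arithmetic : ∀ k s → suc k + suc s + 2 ≡ k + (3 + suc s)
  arithmetic = solve-∀
  k+[3+s]≤n : k + (3 + suc s) ≤ n
  k+[3+s]≤n = subst (_≤ n) (arithmetic k s) t+s+2≤n
  padding : Σ[ v ∈ Subset (n ∸ (3 + suc s)) ] ∣ v ∣ ≡ k
  padding = subset-of-size (m+n≤o⇒m≤o∸n k k+[3+s]≤n)
  v : Subset (n ∸ (3 + suc s))
  v = proj₁ padding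
  ∣v∣≡k : ∣ v ∣ ≡ k
  ∣v∣≡k = proj₂ padding

5+d≤r : ∀ {s L d r p q} → 2 * s + 3 ≤ L → p ≤ s → q ≤ s → L + d + 2 ≤ r + p + q → 5 + d ≤ r
5+d≤r {s} {L} {d} {r} {p} {q} 2s+3≤L p≤s q≤s counted = +-cancelʳ-≤ (s + s) (5 + d) r (begin
  5 + d + (s + s)    ≡⟨ arithmetic s d ⟩
  2 * s + 3 + d + 2  ≤⟨ +-monoˡ-≤ 2 (+-monoˡ-≤ d 2s+3≤L) ⟩
  L + d + 2          ≤⟨ counted ⟩
  r + p + q          ≤⟨ +-mono-≤ (+-monoʳ-≤ r p≤s) q≤s ⟩
  r + s + s          ≡⟨ +-assoc r s s ⟩
  r + (s + s)        ∎)
  where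
  open ≤-Reasoning
  arithmetic : ∀ s d → 5 + d + (s + s) ≡ 2 * s + 3 + d + 2
  arithmetic = solve-∀

lemma6p1 : (n t s : ℕ) → (ht : 1 ≤ t) → (hs : 1 ≤ s) → (hn : t + s + 2 ≤ n) →
    (𝓕 : Family n) → MaxAdmissible t s 𝓕 →
    (A B : Subset n) → A ∈ 𝓕 → B ∈ 𝓕 →
    DiffIs A B (λ x → x ≡ el (four≤ ht hs hn) zero ⊎ x ≡ el (four≤ ht hs hn) (suc zero)) →
    DiffIs B A (λ x → x ≡ el (four≤ ht hs hn) (suc (suc zero)) ⊎ x ≡ el (four≤ ht hs hn) (suc (suc (suc zero)))) →
    (∀ G → G ∈ 𝓕 → G ∉ E (four≤ ht hs hn) A B →
      (G ∈ D 𝓕 A t ⊎ G ∈ D 𝓕 B t) × G ≢ A × G ≢ B)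
    × (5 + length (D 𝓕 A t ∩ᶠ D 𝓕 B t) ≤ length (𝓕 ∩ᶠ E (four≤ ht hs hn) A B)
       × length (𝓕 ∩ᶠ E (four≤ ht hs hn) A B) ≤ 6)
lemma6p1 n t s ht hs hn 𝓕 ((unique , uniform , almost , _) , maximal) A B A∈𝓕 B∈𝓕 A─B B─A =
    (λ G G∈𝓕 G∉E → ∉E⇒∈D G∈𝓕 G∉E , (λ { refl → G∉E A∈E }) , (λ { refl → G∉E B∈E }))
  , 5+d≤r 2s+3≤∣𝓕∣ (almost A A∈𝓕) (almost B B∈𝓕) double-count
  , Unique∧⊆⇒length≤ (Unique.filter⁺ inE? unique) (proj₂ ∘ ∈-filter⁻ inE? {xs = 𝓕})
  where
  h : 4 ≤ n
  h = four≤ ht hs hn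
  open Configuration h A─B B─A
  open InFamily uniform A∈𝓕 B∈𝓕
  2s+3≤∣𝓕∣ : 2 * s + 3 ≤ length 𝓕
  2s+3≤∣𝓕∣ with 𝓖 , 𝓖-admissible , 2s+3≤∣𝓖∣ ← large-admissible-family ht hs hn =
    ≤-trans 2s+3≤∣𝓖∣ (maximal 𝓖 𝓖-admissible)
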